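{- If $A\subseteq\mathbb{N}$ is an $IP^{\star}$ set and $B\subseteq\mathbb{N}$ is an $IP$ set, then \[ \mathbb{Q}_{>0}=\frac{A}{B}=\{a/b:\ a\in A,\ b\in B\}. \]
   Context: $\mathbb{N}$ denotes the positive integers and $\mathbb{Q}_{>0}$ the positive rationals. For a sequence $\langle x_n\rangle_{n\in\mathbb{N}}$ in $\mathbb{N}$, $FS(\langle x_n\rangle_{n\in\mathbb{N}})=\{\sum_{t\in F}x_t:\ F\text{ a nonempty finite subset of }\mathbb{N}\}$. A set is an $IP$ set if it equals $FS(\langle x_n\rangle)$ for some sequence in $\mathbb{N}$. A set $A\subseteq\mathbb{N}$ is an $IP^{\star}$ set if it intersects every $IP$ set. -}

module Defs where

open import Data.Nat using (ℕ; _<_; NonZero)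
open import Data.List using (List; []; map)
open import Data.Nat.ListAction using (sum)
open import Data.List.Relation.Unary.Unique.Propositional using (Unique)
open import Data.Product using (Σ; _×_)
open import Data.Integer using (+_)
open import Data.Rational using (ℚ; _/_)
open import Relation.Binary.PropositionalEquality using (_≡_; _≢_)
open import Function.Bundles using (_⇔_)

-- Subsets of ℕ are predicates ℕ → Set.
-- A nonempty finite subset F of the index set is a nonempty duplicate-free list.
-- m ∈ FS(⟨x_n⟩)  iff  m = Σ_{t∈F} x_t for some nonempty finite F.
FS : (ℕ → ℕ) → ℕ → Set
FS x m = Σ (List ℕ) λ F → (F ≢ []) × Unique F × (sum (map x F) ≡ m)

IsIP : (ℕ → Set) → Set
IsIP B = Σ (ℕ → ℕ) λ x → (∀ n → 0 < x n) × (∀ m → B m ⇔ FS x m)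

IsIPstar : (ℕ → Set) → Set₁
IsIPstar A = (C : ℕ → Set) → IsIP C → Σ ℕ λ n → A n × C n

InQuot : (ℕ → Set) → (ℕ → Set) → ℚ → Set
InQuot A B q = Σ ℕ λ a → Σ ℕ λ b → Σ (NonZero b) λ nz →
  A a × B b × (q ≡ _/_ (+ a) b {{nz}})

{-# OPTIONS --safe #-}
-- Let q = p / d and B = FS(x). Cut the indices into consecutive windows of length d; by
-- pigeonhole on prefix sums, window n contains a nonempty run of consecutive generators whose
-- sum is d · y n. Runs in different windows are disjoint, so d · FS(y) ⊆ FS(x) = B. As FS(p · y)
-- is an IP set, the IP⋆ set A contains p · m for some m ∈ FS(y), and q = (p · m) / (m · d).
module Submission where

open import Defs
open import Data.Nat using (ℕ; zero; suc; pred; _+_; _*_; _≤_; _<_; z<s; NonZero; >-nonZero; >-nonZero⁻¹; _%_; _/_)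
open import Data.Nat.Properties
open import Data.Nat.DivMod using (_mod_; m≡m%n+[m/n]*n; m%n<n; m*n/n≡m; /-monoˡ-≤; m<n*o⇒m/o<n)
open import Data.Nat.Divisibility using (_∣_; divides; quotient; quotient≢0; ∣m+n∣m⇒∣n; n∣m*n)
open import Data.Nat.ListAction using (sum)
open import Data.Nat.ListAction.Properties using (sum-++)
open import Data.List using (List; []; _∷_; _++_; map; concatMap)
open import Data.List.Properties using (map-++; map-cong)
open import Data.List.Relation.Unary.All as All using (All; []; _∷_)
import Data.List.Relation.Unary.All.Properties as All
open import Data.List.Relation.Unary.AllPairs as AllPairs using ([]; _∷_)
import Data.List.Relation.Unary.AllPairs.Properties as AllPairs
open import Data.List.Relation.Unary.Unique.Propositional using (Unique)
open import Data.List.Relation.Unary.Unique.Propositional.Properties using (concat⁺)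
open import Data.List.Relation.Binary.Disjoint.Propositional using (Disjoint)
open import Data.List.Membership.Propositional using (_∈_)
open import Data.Fin using (toℕ)
open import Data.Fin.Properties using (pigeonhole; toℕ-fromℕ<; toℕ<n)
open import Data.Empty using (⊥-elim)
open import Data.Product using (Σ; ∃; ∃₂; _×_; _,_)
open import Relation.Binary.PropositionalEquality
import Data.Integer as ℤ
import Data.Integer.Properties as ℤ
open import Data.Rational as ℚ using (ℚ; 0ℚ; mkℚ) renaming (_<_ to _<ℚ_)
open import Data.Rational.Properties using (↥p/↧p≡p; fromℚᵘ-cong; drop-*<*; normalize-pos; positive⁻¹)
import Data.Rational.Unnormalised as ℚᵘ
open import Function.Bundles using (_⇔_; mk⇔; Equivalence)
open import Function.Construct.Identity using (⇔-id)

sumOver : (ℕ → ℕ) → List ℕ → ℕ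
sumOver x G = sum (map x G)

sumOver-++ : ∀ x G H → sumOver x (G ++ H) ≡ sumOver x G + sumOver x H
sumOver-++ x G H = trans (cong sum (map-++ x G H)) (sum-++ (map x G) (map x H))

sumOver-*ʳ : ∀ x r G → sumOver (λ n → x n * r) G ≡ sumOver x G * r
sumOver-*ʳ x r [] = refl
sumOver-*ʳ x r (g ∷ G) = trans (cong (x g * r +_) (sumOver-*ʳ x r G)) (sym (*-distribʳ-+ r (x g) _))

sumOver-*ˡ : ∀ x k G → sumOver (λ n → k * x n) G ≡ k * sumOver x G
sumOver-*ˡ x k [] = sym (*-zeroʳ k)
sumOver-*ˡ x k (g ∷ G) = trans (cong (k * x g +_) (sumOver-*ˡ x k G)) (sym (*-distribˡ-+ k (x g) _))

sumOver-concatMap : ∀ x (L : ℕ → List ℕ) G → sumOver x (concatMap L G) ≡ sumOver (λ g → sumOver x (L g)) G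
sumOver-concatMap x L [] = refl
sumOver-concatMap x L (g ∷ G) =
  trans (sumOver-++ x (L g) (concatMap L G)) (cong (sumOver x (L g) +_) (sumOver-concatMap x L G))

sumOver-cong : ∀ {x y} → (∀ n → x n ≡ y n) → ∀ G → sumOver x G ≡ sumOver y G
sumOver-cong x≗y G = cong sum (map-cong x≗y G)

interval : ℕ → ℕ → List ℕ
interval a zero = []
interval a (suc l) = a ∷ interval (suc a) l

interval-++ : ∀ a m l → interval a (m + l) ≡ interval a m ++ interval (a + m) l
interval-++ a zero l = cong (λ b → interval b l) (sym (+-identityʳ a))
interval-++ a (suc m) l = cong (a ∷_) (trans (interval-++ (suc a) m l)
  (cong (λ b → interval (suc a) m ++ interval b l) (sym (+-suc a m))))

interval-bounded : ∀ a l → All (λ v → a ≤ v × v < a + l) (interval a l)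
interval-bounded a zero = []
interval-bounded a (suc l) = (≤-refl , a<a+suc-l) ∷ All.map weaken (interval-bounded (suc a) l)
  where
  a<a+suc-l : a < a + suc l
  a<a+suc-l = m<m+n a z<s
  weaken : ∀ {v} → suc a ≤ v × v < suc a + l → a ≤ v × v < a + suc l
  weaken {v} (a<v , v<1+a+l) = <⇒≤ a<v , subst (v <_) (sym (+-suc a l)) v<1+a+l

interval-unique : ∀ a l → Unique (interval a l)
interval-unique a zero = []
interval-unique a (suc l) =
  All.map (λ (a<v , _) a≡v → <-irrefl a≡v a<v) (interval-bounded (suc a) l) ∷ interval-unique (suc a) l

[m+n]%d≡m%d⇒d∣n : ∀ m n d .{{_ : NonZero d}} → (m + n) % d ≡ m % d → d ∣ n
[m+n]%d≡m%d⇒d∣n m n d eq = ∣m+n∣m⇒∣n (divides ((m + n) / d) (+-cancelˡ-≡ (m % d) _ _ shifted)) (n∣m*n (m / d))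
  where
  open ≡-Reasoning
  shifted : m % d + (m / d * d + n) ≡ m % d + (m + n) / d * d
  shifted = begin
    m % d + (m / d * d + n)       ≡⟨ +-assoc (m % d) _ n ⟨
    m % d + m / d * d + n         ≡⟨ cong (_+ n) (m≡m%n+[m/n]*n m d) ⟨
    m + n                         ≡⟨ m≡m%n+[m/n]*n (m + n) d ⟩
    (m + n) % d + (m + n) / d * d ≡⟨ cong (_+ (m + n) / d * d) eq ⟩
    m % d + (m + n) / d * d       ∎

record DivisibleRun (x : ℕ → ℕ) (d s : ℕ) : Set where
  field
    offset length : ℕ
    fits : offset + suc length ≤ d
    divisible : d ∣ sumOver x (interval (s + offset) (suc length))

  run : List ℕ
  run = interval (s + offset) (suc length)

divisibleRun : ∀ x d .{{_ : NonZero d}} s → DivisibleRun x d s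
divisibleRun x d s with pigeonhole (n<1+n d) (λ k → sumOver x (interval s (toℕ k)) mod d)
... | i , j , i<j , same-residue with m≤n⇒∃[o]m+o≡n i<j
... | l , i+1+l≡j = record
  { offset = toℕ i ; length = l
  ; fits = ≤-trans (≤-reflexive i+suc-l≡j) (≤-pred (toℕ<n j))
  ; divisible = [m+n]%d≡m%d⇒d∣n (prefix (toℕ i)) _ d
      (trans (cong (_% d) (sym prefix-j)) (sym residues-agree))
  }
  where
  prefix : ℕ → ℕ
  prefix k = sumOver x (interval s k)
  i+suc-l≡j : toℕ i + suc l ≡ toℕ j
  i+suc-l≡j = trans (+-suc (toℕ i) l) i+1+l≡j
  prefix-j : prefix (toℕ j) ≡ prefix (toℕ i) + sumOver x (interval (s + toℕ i) (suc l))
  prefix-j = begin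
    prefix (toℕ j)                        ≡⟨ cong prefix i+suc-l≡j ⟨
    prefix (toℕ i + suc l)                ≡⟨ cong (sumOver x) (interval-++ s (toℕ i) (suc l)) ⟩
    sumOver x (interval s (toℕ i) ++ _)   ≡⟨ sumOver-++ x (interval s (toℕ i)) _ ⟩
    prefix (toℕ i) + sumOver x (interval (s + toℕ i) (suc l)) ∎
    where open ≡-Reasoning
  residues-agree : prefix (toℕ i) % d ≡ prefix (toℕ j) % d
  residues-agree = trans (sym (toℕ-fromℕ< (m%n<n _ d))) (trans (cong toℕ same-residue) (toℕ-fromℕ< (m%n<n _ d)))

window-index : ∀ n d .{{_ : NonZero d}} {v} → n * d ≤ v → v < n * d + d → v / d ≡ n
window-index n d {v} lo hi = ≤-antisym (≤-pred (m<n*o⇒m/o<n (subst (v <_) (+-comm (n * d) d) hi)))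
  (subst (_≤ v / d) (m*n/n≡m n d) (/-monoˡ-≤ d lo))

concatMap-unique : ∀ {A B : Set} (L : A → List B) {G} → (∀ g → Unique (L g)) →
  (∀ {g h} → g ≢ h → Disjoint (L g) (L h)) → Unique G → Unique (concatMap L G)
concatMap-unique L L! disjoint G! =
  concat⁺ (All.map⁺ (All.tabulate (λ {g} _ → L! g))) (AllPairs.map⁺ (AllPairs.map disjoint G!))

FS-pos : ∀ {y m} → (∀ n → 0 < y n) → FS y m → 0 < m
FS-pos y>0 ([] , []≢[] , _) = ⊥-elim ([]≢[] refl)
FS-pos y>0 (g ∷ G , _ , _ , refl) = <-≤-trans (y>0 g) (m≤m+n _ _)

module Blocks (x : ℕ → ℕ) (x>0 : ∀ n → 0 < x n) (d : ℕ) .{{_ : NonZero d}} where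

  blockRun : ∀ n → DivisibleRun x d (n * d)
  blockRun n = divisibleRun x d (n * d)

  block : ℕ → List ℕ
  block n = DivisibleRun.run (blockRun n)

  blockQuotient : ℕ → ℕ
  blockQuotient n = quotient (DivisibleRun.divisible (blockRun n))

  sumOver-block : ∀ n → sumOver x (block n) ≡ blockQuotient n * d
  sumOver-block n = _∣_.equality (DivisibleRun.divisible (blockRun n))

  blockQuotient-pos : ∀ n → 0 < blockQuotient n
  blockQuotient-pos n = >-nonZero⁻¹ _ {{quotient≢0 (DivisibleRun.divisible (blockRun n)) {{>-nonZero sum>0}}}}
    where
    sum>0 : 0 < sumOver x (block n)
    sum>0 = FS-pos x>0 (block n , (λ ()) , interval-unique _ _ , refl)

  ∈block⇒/≡ : ∀ n {v} → v ∈ block n → v / d ≡ n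
  ∈block⇒/≡ n v∈block with All.lookup (interval-bounded _ _) v∈block
  ... | lo , hi = window-index n d (≤-trans (m≤m+n _ _) lo) (<-≤-trans hi run-end≤window-end)
    where
    open DivisibleRun (blockRun n)
    run-end≤window-end : n * d + offset + suc length ≤ n * d + d
    run-end≤window-end = ≤-trans (≤-reflexive (+-assoc (n * d) offset (suc length))) (+-monoʳ-≤ (n * d) fits)

  block-disjoint : ∀ {g h} → g ≢ h → Disjoint (block g) (block h)
  block-disjoint g≢h (v∈g , v∈h) = g≢h (trans (sym (∈block⇒/≡ _ v∈g)) (∈block⇒/≡ _ v∈h))

  blocks-nonempty : ∀ {G} → G ≢ [] → concatMap block G ≢ []
  blocks-nonempty {[]} []≢[] = ⊥-elim ([]≢[] refl)
  blocks-nonempty {g ∷ G} _ ()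

  sumOver-blocks : ∀ G → sumOver x (concatMap block G) ≡ sumOver blockQuotient G * d
  sumOver-blocks G = begin
    sumOver x (concatMap block G)                  ≡⟨ sumOver-concatMap x block G ⟩
    sumOver (λ g → sumOver x (block g)) G          ≡⟨ sumOver-cong sumOver-block G ⟩
    sumOver (λ g → blockQuotient g * d) G          ≡⟨ sumOver-*ʳ blockQuotient d G ⟩
    sumOver blockQuotient G * d                    ∎
    where open ≡-Reasoning

IP-contains-dilatedIP : ∀ x → (∀ n → 0 < x n) → ∀ d .{{_ : NonZero d}} →
  Σ (ℕ → ℕ) λ y → (∀ n → 0 < y n) × (∀ {m} → FS y m → FS x (m * d))
IP-contains-dilatedIP x x>0 d = blockQuotient , blockQuotient-pos , FS-blocks
  where
  open Blocks x x>0 d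
  FS-blocks : ∀ {m} → FS blockQuotient m → FS x (m * d)
  FS-blocks (G , G≢[] , G! , refl) =
    concatMap block G , blocks-nonempty G≢[] , concatMap-unique block (λ _ → interval-unique _ _) block-disjoint G! , sumOver-blocks G

IPstar-meets-dilatedFS : ∀ {A} → IsIPstar A → ∀ y → (∀ n → 0 < y n) → ∀ k → 0 < k →
  ∃ λ m → FS y m × A (k * m)
IPstar-meets-dilatedFS {A} A⋆ y y>0 k k>0
  with A⋆ (FS (λ n → k * y n)) ((λ n → k * y n) , (λ n → *-mono-< k>0 (y>0 n)) , λ _ → ⇔-id _)
... | _ , a∈A , G , G≢[] , G! , refl = sumOver y G , (G , G≢[] , G! , refl) , subst A (sumOver-*ˡ y k G) a∈A

0<+a/b : ∀ a b .{{_ : NonZero b}} → 0 < a → 0ℚ <ℚ ℤ.+ a ℚ./ b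
0<+a/b (suc a) b _ = positive⁻¹ _ {{normalize-pos (suc a) b}}

+[a*m]/[m*b]≡+a/b : ∀ a m b .{{_ : NonZero m}} .{{_ : NonZero b}} →
  (ℤ.+ (a * m) ℚ./ (m * b)) {{m*n≢0 m b}} ≡ ℤ.+ a ℚ./ b
+[a*m]/[m*b]≡+a/b a m@(suc _) b@(suc b-1) =
  fromℚᵘ-cong {ℚᵘ.mkℚᵘ (ℤ.+ (a * m)) (pred (m * b))} {ℚᵘ.mkℚᵘ (ℤ.+ a) b-1} (ℚᵘ.*≡* (begin
  ℤ.+ (a * m) ℤ.* ℤ.+ b  ≡⟨ ℤ.pos-* (a * m) b ⟨
  ℤ.+ (a * m * b)        ≡⟨ cong ℤ.+_ (*-assoc a m b) ⟩
  ℤ.+ (a * (m * b))      ≡⟨ ℤ.pos-* a (m * b) ⟩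
  ℤ.+ a ℤ.* ℤ.+ (m * b)  ∎))
  where open ≡-Reasoning

0<q⇒q≡+[1+p]/[1+d] : ∀ q → 0ℚ <ℚ q → ∃₂ λ p d → q ≡ ℤ.+ suc p ℚ./ suc d
0<q⇒q≡+[1+p]/[1+d] q@(mkℚ (ℤ.+ suc p) d _) _ = p , d , sym (↥p/↧p≡p q)
0<q⇒q≡+[1+p]/[1+d] (mkℚ (ℤ.+ zero) _ _) 0<q with drop-*<* 0<q
... | ℤ.+<+ ()
0<q⇒q≡+[1+p]/[1+d] (mkℚ ℤ.-[1+ _ ] _ _) 0<q with drop-*<* 0<q
... | ()

mainTheorem10 : (A B : ℕ → Set) → (∀ n → A n → 0 < n) → IsIPstar A → IsIP B →
    ∀ (q : ℚ) → (0ℚ <ℚ q) ⇔ InQuot A B q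
mainTheorem10 A B A>0 A⋆ (x , x>0 , B⇔FSx) q = mk⇔ (0<q⇒q∈A/B q) q∈A/B⇒0<q
  where
  q∈A/B⇒0<q : InQuot A B q → 0ℚ <ℚ q
  q∈A/B⇒0<q (a , b , b≢0 , a∈A , _ , refl) = 0<+a/b a b {{b≢0}} (A>0 a a∈A)

  0<q⇒q∈A/B : ∀ q → 0ℚ <ℚ q → InQuot A B q
  0<q⇒q∈A/B q 0<q with 0<q⇒q≡+[1+p]/[1+d] q 0<q
  ... | p , d , refl with IP-contains-dilatedIP x x>0 (suc d)
  ... | y , y>0 , dilate with IPstar-meets-dilatedFS A⋆ y y>0 (suc p) z<s
  ... | m , m∈FSy , a∈A =
    suc p * m , m * suc d , m*n≢0 m (suc d) , a∈A , Equivalence.from (B⇔FSx _) (dilate m∈FSy) ,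
    sym (+[a*m]/[m*b]≡+a/b (suc p) m (suc d))
    where instance
      m≢0 : NonZero m
      m≢0 = >-nonZero (FS-pos y>0 m∈FSy)
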